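{- Let $\Gamma$ be an LHS-commutation system for $\underline{\mathcal D}$ over $F$. If there exists a $\underline{\mathcal D}^\Gamma$-ring $(R,\underline e)$ in which the operators $(\partial_{u,i}:u\in\{1,2\},1\le i\le m_u)$, $(\partial_{1,i}\partial_{1,j}:1\le i\le j\le m_1)$ and $(\partial_{1,i}\partial_{2,j}:1\le i\le m_1,1\le j\le m_2)$ are together $F$-linearly independent as functions $R\to R$, then $\Gamma$ is Jacobi-associative.
   Context: Let $k$ be a field. A local operator-system $(\mathcal D,\bar\epsilon)$: $\mathcal D$ a finite-dimensional commutative local $k$-algebra with maximal ideal $\mathfrak m$ and residue field $k$, $\bar\epsilon=(1,\epsilon_1,\dots,\epsilon_m)$ a ranked basis (consecutive blocks lie in $\mathfrak m^j$ and project to bases of $\mathfrak m^j/\mathfrak m^{j+1}$). Fix two of them $(\mathcal D_u,\bar\epsilon_u)$, $u=1,2$, $\dim\mathcal D_u=m_u+1$, maximal ideals $\mathfrak m_u$, $\alpha^{pq}_{u,i}$ the coefficient of $\epsilon_{u,i}$ in $\epsilon_{u,p}\epsilon_{u,q}$. A $\underline{\mathcal D}$-ring is a $k$-algebra $R$ with $k$-algebra homomorphisms $e_u:R\to\mathcal D_u\otimes_kR$, $e_u(x)=1\otimes x+\sum_i\epsilon_{u,i}\otimes\partial_{u,i}(x)$. A $\underline{\mathcal D}$-field $(F,\underline e)$ is fixed; all rings are $F$-algebras and $\underline{\mathcal D}$-rings are $\underline{\mathcal D}$-algebras over $F$. An LHS-commutation system $\Gamma=\{r_1,r_2\}$: $k$-algebra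 homomorphisms $r_u:\mathcal D_u\to\mathcal D_u\otimes_k\mathcal D_u\otimes_kF$ with $r_1(\epsilon_{1,\ell})=1\otimes\epsilon_{1,\ell}\otimes1+\sum_{i,j}\epsilon_{1,i}\otimes\epsilon_{1,j}\otimes c^{ji}_{1,\ell}$, where $c^{ij}_{1,\ell}\in F$ vanishes unless $\epsilon_{1,i}\mathfrak m_1=\epsilon_{1,j}\mathfrak m_1=0$, and $r_2(\epsilon_{2,\ell})=\epsilon_{2,\ell}\otimes1\otimes1+1\otimes\epsilon_{2,\ell}\otimes1+\sum_{i,j}\epsilon_{2,i}\otimes\epsilon_{2,j}\otimes c^{ij}_{2,\ell}$, $c^{ij}_{2,\ell}\in F$. A $\underline{\mathcal D}^\Gamma$-ring is a $\underline{\mathcal D}$-ring (over $F$) with $[\partial_{1,i},\partial_{1,j}]=\sum_\ell c^{ij}_{1,\ell}\partial_{1,\ell}$, $\partial_{2,i}\partial_{2,j}=\sum_\ell c^{ij}_{2,\ell}\partial_{2,\ell}$, $[\partial_{1,i},\partial_{2,j}]=0$. $\Gamma$ is Jacobi-associative if (with $\partial_{u,i}$ the operators on $F$): (a) each $(c^{ij}_{1,\ell})_{i,j}$ is skew-symmetric; (b) for all $i,j,k,s\le m_1$, $\sum_\ell(c^{ij}_{1,\ell}c^{\ell k}_{1,s}+c^{ki}_{1,\ell}c^{\ell j}_{1,s}+c^{jk}_{1,\ell}c^{\ell i}_{1,s})=\partial_{1,i}(c^{jk}_{1,s})+\partial_{1,k}(c^{ij}_{1,s})+\partial_{1,j}(c^{ki}_{1,s})$;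 (c) $\sum_p(\alpha^{ps}_{1,i}\partial_{1,p}(c^{jk}_{1,s})+\alpha^{ps}_{1,k}\partial_{1,p}(c^{ij}_{1,s})+\alpha^{ps}_{1,j}\partial_{1,p}(c^{ki}_{1,s}))=0$ for all $i,j,k,s$, and for $q<s$: $\sum_p(\alpha^{pq}_{1,i}\partial_{1,p}(c^{jk}_{1,s})+\alpha^{pq}_{1,k}\partial_{1,p}(c^{ij}_{1,s})+\alpha^{pq}_{1,j}\partial_{1,p}(c^{ki}_{1,s})+\alpha^{ps}_{1,i}\partial_{1,p}(c^{jk}_{1,q})+\alpha^{ps}_{1,k}\partial_{1,p}(c^{ij}_{1,q})+\alpha^{ps}_{1,j}\partial_{1,p}(c^{ki}_{1,q}))=0$; (d) for all $i,j,k,s\le m_2$, $\sum_\ell(c^{ij}_{2,\ell}c^{\ell k}_{2,s}-c^{jk}_{2,\ell}c^{i\ell}_{2,s}-\sum_{p,q}\alpha^{pq}_{2,i}\partial_{2,p}(c^{jk}_{2,\ell})c^{q\ell}_{2,s})=\partial_{2,i}(c^{jk}_{2,s})$; (e) $\partial_{u,k}(c^{ij}_{v,s})=0$ whenever $u\neq v$. -}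

module Defs where

open import Level using (0ℓ)
open import Algebra.Bundles using (CommutativeRing)
open import Algebra.Morphism.Structures using (IsRingHomomorphism)
open import Data.Nat as ℕ using (ℕ; zero; suc)
open import Data.Fin as Fin using (Fin; zero; suc)
open import Data.Product using (Σ; _×_; _,_)
open import Data.Sum using (_⊎_)
open import Data.Bool using (if_then_else_)
open import Relation.Nullary using (¬_; does)
open import Relation.Binary.PropositionalEquality using (_≡_)
import Algebra.Properties.Monoid.Sum as MSum

record Field : Set₁ where
  field
    commRing : CommutativeRing 0ℓ 0ℓ
  open CommutativeRing commRing public
  field
    0≉1     : ¬ (0# ≈ 1#)
    inverse : ∀ x → ¬ (x ≈ 0#) → Σ Carrier (λ y → x * y ≈ 1#)

∑ : (A : CommutativeRing 0ℓ 0ℓ) {n : ℕ} →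
    (Fin n → CommutativeRing.Carrier A) → CommutativeRing.Carrier A
∑ A = MSum.sum (CommutativeRing.+-monoid A)

δ : (A : CommutativeRing 0ℓ 0ℓ) {n : ℕ} → Fin n → Fin n → CommutativeRing.Carrier A
δ A i j = if does (i Fin.≟ j) then CommutativeRing.1# A else CommutativeRing.0# A

IsRingHom : (A B : CommutativeRing 0ℓ 0ℓ) →
            (CommutativeRing.Carrier A → CommutativeRing.Carrier B) → Set
IsRingHom A B f =
  IsRingHomomorphism (CommutativeRing.rawRing A) (CommutativeRing.rawRing B) f

-- D = k^{m+1} with basis ε_0 = 1, ε_1, …, ε_m;  α p q i = coefficient
-- of ε_i in ε_p ε_q.  The maximal ideal 𝔪 is the span of ε_1 … ε_m
-- (forced by the ranked-basis condition: block 0 is {1}, all other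
-- blocks lie in 𝔪).

module OpSys (k : Field) (m : ℕ)
             (α : Fin (suc m) → Fin (suc m) → Fin (suc m) → Field.Carrier k) where
  private
    module K = Field k
    K = K.Carrier
    ∑k = ∑ K.commRing

  Elt : Set
  Elt = Fin (suc m) → K

  mul : Elt → Elt → Elt
  mul v w i = ∑k (λ p → ∑k (λ q → α p q i K.* v p K.* w q))

  basis : Fin (suc m) → Elt
  basis p = δ K.commRing p

  sub : Elt → Elt → Elt
  sub v w i = v i K.- w i

  In𝔪 : Elt → Set
  In𝔪 v = v zero K.≈ K.0#

  -- the ideal power 𝔪^j: 𝔪^0 = D, 𝔪^{j+1} = additive span of products a b
  -- with a ∈ 𝔪, b ∈ 𝔪^j
  data Pow : ℕ → Elt → Set where
    pow-0   : ∀ v → Pow 0 v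
    pow-zero : ∀ {j v} → (∀ i → v i K.≈ K.0#) → Pow (suc j) v
    pow-mul : ∀ {j a b v} → In𝔪 a → Pow j b → (∀ i → v i K.≈ mul a b i) →
              Pow (suc j) v
    pow-add : ∀ {j a b v} → Pow (suc j) a → Pow (suc j) b →
              (∀ i → v i K.≈ a i K.+ b i) → Pow (suc j) v

  -- Σ_{i : rank i = j} λ_i ε_{i}   (basis elements ε_1 … ε_m indexed by Fin m)
  blk : (Fin m → ℕ) → ℕ → (Fin m → K) → Elt
  blk rank j λ′ zero    = K.0#
  blk rank j λ′ (suc i) = if does (rank i ℕ.≟ j) then λ′ i else K.0#

  record IsLocalOpSystem : Set where
    field
      unitˡ : ∀ q i → α zero q i K.≈ δ K.commRing q i
      comm  : ∀ p q i → α p q i K.≈ α q p i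
      assoc : ∀ p q s t → ∑k (λ i → α p q i K.* α i s t) K.≈ ∑k (λ i → α q s i K.* α p i t)
      -- 𝔪 = span(ε_1..ε_m) is an ideal, and everything outside 𝔪 is a unit:
      -- D is local with maximal ideal 𝔪 and residue field k
      𝔪-ideal : ∀ p q → α (suc p) (suc q) zero K.≈ K.0#
      local   : ∀ v → ¬ In𝔪 v → Σ Elt (λ w → ∀ i → mul v w i K.≈ basis zero i)
      -- ranked basis: ε_1..ε_m are split into consecutive blocks
      -- (block of ε_{i} is rank i ≥ 1); block j lies in 𝔪^j and projects
      -- to a basis of 𝔪^j / 𝔪^{j+1}
      rank      : Fin m → ℕ
      rank-pos  : ∀ i → 1 ℕ.≤ rank i
      rank-mono : ∀ i j → i Fin.≤ j → rank i ℕ.≤ rank j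
      rank-in   : ∀ i → Pow (rank i) (basis (suc i))
      rank-indep : ∀ j (λ′ : Fin m → K) → Pow (suc (suc j)) (blk rank (suc j) λ′) →
                   ∀ i → rank i ≡ suc j → λ′ i K.≈ K.0#
      rank-span  : ∀ j v → Pow (suc j) v →
                   Σ (Fin m → K) (λ λ′ → Pow (suc (suc j)) (sub v (blk rank (suc j) λ′)))

record LocalOpSystem (k : Field) : Set where
  field
    m : ℕ
    α : Fin (suc m) → Fin (suc m) → Fin (suc m) → Field.Carrier k
    isLocalOpSystem : OpSys.IsLocalOpSystem k m α

-- D-structure on a k-algebra A (structure map φ : k → A):
-- e(x) = 1 ⊗ x + Σ_i ε_i ⊗ ∂_i x  is a k-algebra homomorphism A → D ⊗_k A.

module DStr (k : Field) (D : LocalOpSystem k) (A : CommutativeRing 0ℓ 0ℓ)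
            (φ : Field.Carrier k → CommutativeRing.Carrier A) where
  open LocalOpSystem D
  private module A = CommutativeRing A

  E : (Fin m → A.Carrier → A.Carrier) → A.Carrier → Fin (suc m) → A.Carrier
  E ∂ x zero    = x
  E ∂ x (suc i) = ∂ i x

  record IsDStructure (∂ : Fin m → A.Carrier → A.Carrier) : Set where
    field
      ∂-cong   : ∀ i {x y} → x A.≈ y → ∂ i x A.≈ ∂ i y
      ∂-+      : ∀ i x y → ∂ i (x A.+ y) A.≈ ∂ i x A.+ ∂ i y
      ∂-scalar : ∀ i (c : Field.Carrier k) → ∂ i (φ c) A.≈ A.0#
      e-*      : ∀ i x y → E ∂ (x A.* y) i A.≈
                   ∑ A (λ p → ∑ A (λ q → φ (α p q i) A.* E ∂ x p A.* E ∂ y q))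

record DField (k : Field) (D₁ D₂ : LocalOpSystem k) : Set₁ where
  field
    F     : Field
    ι     : Field.Carrier k → Field.Carrier F
    ι-hom : IsRingHom (Field.commRing k) (Field.commRing F) ι
    ∂₁    : Fin (LocalOpSystem.m D₁) → Field.Carrier F → Field.Carrier F
    ∂₂    : Fin (LocalOpSystem.m D₂) → Field.Carrier F → Field.Carrier F
    isD₁  : DStr.IsDStructure k D₁ (Field.commRing F) ι ∂₁
    isD₂  : DStr.IsDStructure k D₂ (Field.commRing F) ι ∂₂

-- Elements of D ⊗_k D ⊗_k F in coordinates: T a b = coefficient of ε_a ⊗ ε_b.

module Tensor (k : Field) (D : LocalOpSystem k) (F : Field)
              (ι : Field.Carrier k → Field.Carrier F) where
  open LocalOpSystem D
  private module F = Field F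

  T : Set
  T = Fin (suc m) → Fin (suc m) → F.Carrier

  mul3 : T → T → T
  mul3 S U x y = ∑ F.commRing (λ a → ∑ F.commRing (λ b → ∑ F.commRing (λ c → ∑ F.commRing (λ d →
                   ι (α a c x) F.* ι (α b d y) F.* S a b F.* U c d))))

  -- the k-linear map r : D → D ⊗ D ⊗ F determined by its values on the basis
  -- is a k-algebra homomorphism
  IsAlgHom : (Fin (suc m) → T) → Set
  IsAlgHom r = ∀ p q x y →
    mul3 (r p) (r q) x y F.≈ ∑ F.commRing (λ i → ι (α p q i) F.* r i x y)

  -- r(1) = 1 ⊗ 1 ⊗ 1  and, for ℓ ≥ 1,
  --   r₁(ε_ℓ) = 1 ⊗ ε_ℓ ⊗ 1 + Σ_{i,j} ε_i ⊗ ε_j ⊗ c^{ji}_ℓ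
  r₁ : (Fin m → Fin m → Fin m → F.Carrier) → Fin (suc m) → T
  r₁ c zero    zero    zero    = F.1#
  r₁ c zero    zero    (suc _) = F.0#
  r₁ c zero    (suc _) _       = F.0#
  r₁ c (suc l) zero    b       = δ F.commRing b (suc l)
  r₁ c (suc l) (suc i) zero    = F.0#
  r₁ c (suc l) (suc i) (suc j) = c j i l

  --   r₂(ε_ℓ) = ε_ℓ ⊗ 1 ⊗ 1 + 1 ⊗ ε_ℓ ⊗ 1 + Σ_{i,j} ε_i ⊗ ε_j ⊗ c^{ij}_ℓ
  r₂ : (Fin m → Fin m → Fin m → F.Carrier) → Fin (suc m) → T
  r₂ c zero    zero    zero    = F.1#
  r₂ c zero    zero    (suc _) = F.0#
  r₂ c zero    (suc _) _       = F.0#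
  r₂ c (suc l) zero    zero    = F.0#
  r₂ c (suc l) zero    (suc j) = δ F.commRing j l
  r₂ c (suc l) (suc i) zero    = δ F.commRing i l
  r₂ c (suc l) (suc i) (suc j) = c i j l

-- LHS-commutation systems  Γ = {r₁, r₂}, given by the constants
-- c₁ i j ℓ = c^{ij}_{1,ℓ}  and  c₂ i j ℓ = c^{ij}_{2,ℓ}.

record LHSCommSystem {k : Field} {D₁ D₂ : LocalOpSystem k} (𝔽 : DField k D₁ D₂) : Set where
  open DField 𝔽
  private
    module F = Field F
    m₁ = LocalOpSystem.m D₁
    m₂ = LocalOpSystem.m D₂
    α₁ = LocalOpSystem.α D₁
  -- ε_{1,i} 𝔪₁ = 0
  Ann₁ : Fin m₁ → Set
  Ann₁ i = ∀ p x → Field._≈_ k (α₁ (suc i) (suc p) x) (Field.0# k)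
  field
    c₁ : Fin m₁ → Fin m₁ → Fin m₁ → F.Carrier
    c₂ : Fin m₂ → Fin m₂ → Fin m₂ → F.Carrier
    r₁-hom : Tensor.IsAlgHom k D₁ F ι (Tensor.r₁ k D₁ F ι c₁)
    r₂-hom : Tensor.IsAlgHom k D₂ F ι (Tensor.r₂ k D₂ F ι c₂)
    c₁-vanish : ∀ i j ℓ → (c₁ i j ℓ F.≈ F.0#) ⊎ (Ann₁ i × Ann₁ j)

record DΓRing {k : Field} {D₁ D₂ : LocalOpSystem k} {𝔽 : DField k D₁ D₂}
              (Γ : LHSCommSystem 𝔽) : Set₁ where
  private
    module 𝔽 = DField 𝔽
    module Γ = LHSCommSystem Γ
    module F = Field 𝔽.F
    m₁ = LocalOpSystem.m D₁
    m₂ = LocalOpSystem.m D₂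
  field
    R     : CommutativeRing 0ℓ 0ℓ
  private module R = CommutativeRing R
  field
    ιR     : F.Carrier → R.Carrier
    ιR-hom : IsRingHom F.commRing R ιR
    ∂₁    : Fin m₁ → R.Carrier → R.Carrier
    ∂₂    : Fin m₂ → R.Carrier → R.Carrier
    isD₁  : DStr.IsDStructure k D₁ R (λ c → ιR (𝔽.ι c)) ∂₁
    isD₂  : DStr.IsDStructure k D₂ R (λ c → ιR (𝔽.ι c)) ∂₂
    ιR-∂₁ : ∀ i f → ∂₁ i (ιR f) R.≈ ιR (𝔽.∂₁ i f)
    ιR-∂₂ : ∀ i f → ∂₂ i (ιR f) R.≈ ιR (𝔽.∂₂ i f)
    comm₁  : ∀ i j x → ∂₁ i (∂₁ j x) R.- ∂₁ j (∂₁ i x) R.≈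
               ∑ R (λ ℓ → ιR (Γ.c₁ i j ℓ) R.* ∂₁ ℓ x)
    comm₂  : ∀ i j x → ∂₂ i (∂₂ j x) R.≈ ∑ R (λ ℓ → ιR (Γ.c₂ i j ℓ) R.* ∂₂ ℓ x)
    comm₁₂ : ∀ i j x → ∂₁ i (∂₂ j x) R.≈ ∂₂ j (∂₁ i x)

Independent : {k : Field} {D₁ D₂ : LocalOpSystem k} {𝔽 : DField k D₁ D₂}
              {Γ : LHSCommSystem 𝔽} → DΓRing Γ → Set
Independent {k} {D₁} {D₂} {𝔽} {Γ} ℛ =
  ∀ (a₁ : Fin m₁ → F.Carrier) (a₂ : Fin m₂ → F.Carrier)
    (b : Fin m₁ → Fin m₁ → F.Carrier) (d : Fin m₁ → Fin m₂ → F.Carrier) →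
  (∀ x → (∑ R (λ i → ιR (a₁ i) R.* ∂₁ i x)
          R.+ ∑ R (λ i → ιR (a₂ i) R.* ∂₂ i x)
          R.+ ∑ R (λ i → ∑ R (λ j →
                if does (i Fin.≤? j) then ιR (b i j) R.* ∂₁ i (∂₁ j x) else R.0#))
          R.+ ∑ R (λ i → ∑ R (λ j → ιR (d i j) R.* ∂₁ i (∂₂ j x))))
         R.≈ R.0#) →
  (∀ i → a₁ i F.≈ F.0#) × (∀ i → a₂ i F.≈ F.0#) ×
  (∀ i j → i Fin.≤ j → b i j F.≈ F.0#) × (∀ i j → d i j F.≈ F.0#)
  where
    open DΓRing ℛ
    module F = Field (DField.F 𝔽)
    module R = CommutativeRing R
    m₁ = LocalOpSystem.m D₁
    m₂ = LocalOpSystem.m D₂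

record JacobiAssociative {k : Field} {D₁ D₂ : LocalOpSystem k} {𝔽 : DField k D₁ D₂}
                         (Γ : LHSCommSystem 𝔽) : Set where
  private
    module 𝔽 = DField 𝔽
    module F = Field 𝔽.F
    m₁ = LocalOpSystem.m D₁
    m₂ = LocalOpSystem.m D₂
    α₁ = LocalOpSystem.α D₁
    α₂ = LocalOpSystem.α D₂
    ∑F = ∑ F.commRing
    ι = 𝔽.ι
    ∂₁ = 𝔽.∂₁
    ∂₂ = 𝔽.∂₂
  open LHSCommSystem Γ using (c₁; c₂)
  field
    skew : ∀ i j ℓ → c₁ i j ℓ F.≈ F.- c₁ j i ℓ
    jacobi : ∀ i j k′ s →
      ∑F (λ ℓ → c₁ i j ℓ F.* c₁ ℓ k′ s F.+ c₁ k′ i ℓ F.* c₁ ℓ j s F.+ c₁ j k′ ℓ F.* c₁ ℓ i s)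
      F.≈ ∂₁ i (c₁ j k′ s) F.+ ∂₁ k′ (c₁ i j s) F.+ ∂₁ j (c₁ k′ i s)
    mixed₁ : ∀ i j k′ s →
      ∑F (λ p → ι (α₁ (suc p) (suc s) (suc i)) F.* ∂₁ p (c₁ j k′ s)
              F.+ ι (α₁ (suc p) (suc s) (suc k′)) F.* ∂₁ p (c₁ i j s)
              F.+ ι (α₁ (suc p) (suc s) (suc j)) F.* ∂₁ p (c₁ k′ i s))
      F.≈ F.0#
    mixed₂ : ∀ i j k′ q s → q Fin.< s →
      ∑F (λ p → ι (α₁ (suc p) (suc q) (suc i)) F.* ∂₁ p (c₁ j k′ s)
              F.+ ι (α₁ (suc p) (suc q) (suc k′)) F.* ∂₁ p (c₁ i j s)
              F.+ ι (α₁ (suc p) (suc q) (suc j)) F.* ∂₁ p (c₁ k′ i s)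
              F.+ ι (α₁ (suc p) (suc s) (suc i)) F.* ∂₁ p (c₁ j k′ q)
              F.+ ι (α₁ (suc p) (suc s) (suc k′)) F.* ∂₁ p (c₁ i j q)
              F.+ ι (α₁ (suc p) (suc s) (suc j)) F.* ∂₁ p (c₁ k′ i q))
      F.≈ F.0#
    assoc₂ : ∀ i j k′ s →
      ∑F (λ ℓ → c₂ i j ℓ F.* c₂ ℓ k′ s F.- c₂ j k′ ℓ F.* c₂ i ℓ s
               F.- ∑F (λ p → ∑F (λ q →
                     ι (α₂ (suc p) (suc q) (suc i)) F.* ∂₂ p (c₂ j k′ ℓ) F.* c₂ q ℓ s)))
      F.≈ ∂₂ i (c₂ j k′ s)
    indep₁₂ : ∀ k′ i j s → ∂₁ k′ (c₂ i j s) F.≈ F.0#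
    indep₂₁ : ∀ k′ i j s → ∂₂ k′ (c₁ i j s) F.≈ F.0#

-- Every commutation relation of Γ holds identically on R, so differentiating it or
-- combining it with others yields identities Σ (coefficient) · (operator) x = 0 in which only the
-- operators ∂_{u,i}, ∂_{1,i}∂_{1,j} (i ≤ j) and ∂_{1,i}∂_{2,j} occur; by independence every
-- coefficient vanishes, and these coefficients are exactly the conditions (a)–(e). The coefficients
-- come from the Leibniz rule ∂_c (f y) = f ∂_c y + ∂_c f y + Σ_{p,q} α^{pq}_c ∂_p f ∂_q y, which
-- is the statement that e is multiplicative. (a) compares [∂_i,∂_j] with -[∂_j,∂_i]; (d) expands
-- ∂_{2,i}∂_{2,j}∂_{2,k} in two ways; (e) applies ∂_{u,k} to a relation of the other family; (b)
-- and (c) are the first- and second-order parts of the Jacobi identity for commutators, after the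
-- second-order part is put in the normal form ∂_q ∂_ℓ with q ≤ ℓ.

module Submission where

open import Defs
open import Level using (0ℓ)
open import Algebra.Bundles using (CommutativeRing)
open import Algebra.Morphism.Structures using (IsMonoidHomomorphism; IsRingHomomorphism)
open import Data.Bool using (true; false; if_then_else_)
open import Data.Fin as Fin using (Fin; zero; suc)
open import Data.Nat using (ℕ; zero; suc)
open import Function using (_∘_)
open import Relation.Nullary using (Dec; yes; no; does; contradiction)
open import Relation.Binary.PropositionalEquality using (_≡_; _≢_) renaming (refl to ≡-refl; sym to ≡-sym)
open import Data.Sum using (inj₁; inj₂; [_,_]′)
open import Data.Product using (Σ; _×_; _,_; proj₁; proj₂)
import Data.Fin.Properties as Finₚ
import Data.Nat.Properties as ℕₚ
open import Algebra.Morphism.Construct.Composition using (isRingHomomorphism)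
import Algebra.Properties.Ring

module SumProperties (A : CommutativeRing 0ℓ 0ℓ) where
  open CommutativeRing A
  open import Algebra.Properties.Ring ring using (-1*x≈-x)
  open import Algebra.Properties.Semiring.Sum semiring public
    using (∑-distrib-+; ∑-comm; *-distribˡ-sum; *-distribʳ-sum)
  open import Algebra.Properties.Semiring.Sum semiring public using () renaming (sum-cong-≋ to ∑-cong)
  open import Algebra.Properties.Semiring.Sum semiring using (sum-replicate-zero)
  open import Relation.Binary.Reasoning.Setoid setoid

  ∑-zero : ∀ {n} {f : Fin n → Carrier} → (∀ i → f i ≈ 0#) → ∑ A f ≈ 0#
  ∑-zero {n} f≈0 = trans (∑-cong f≈0) (sum-replicate-zero n)

  -‿distrib-∑ : ∀ {n} (f : Fin n → Carrier) → - ∑ A f ≈ ∑ A (λ i → - f i)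
  -‿distrib-∑ f = begin
    - ∑ A f                 ≈⟨ -1*x≈-x _ ⟨
    - 1# * ∑ A f            ≈⟨ *-distribˡ-sum (- 1#) f ⟩
    ∑ A (λ i → - 1# * f i)  ≈⟨ ∑-cong (-1*x≈-x ∘ f) ⟩
    ∑ A (λ i → - f i)       ∎

  ∑-distrib-- : ∀ {n} (f g : Fin n → Carrier) → ∑ A (λ i → f i - g i) ≈ ∑ A f - ∑ A g
  ∑-distrib-- f g = trans (∑-distrib-+ f (λ i → - g i)) (+-congˡ (sym (-‿distrib-∑ g)))

  ∑-distrib-+₃ : ∀ {n} (f g h : Fin n → Carrier) →
                 ∑ A (λ i → f i + g i + h i) ≈ ∑ A f + ∑ A g + ∑ A h
  ∑-distrib-+₃ f g h = trans (∑-distrib-+ (λ i → f i + g i) h) (+-congʳ (∑-distrib-+ f g))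

  ∑-δ : ∀ {n} (j : Fin n) (f : Fin n → Carrier) → ∑ A (λ i → δ A i j * f i) ≈ f j
  ∑-δ zero    f = trans (+-cong (*-identityˡ _) (∑-zero (λ i → zeroˡ (f (suc i))))) (+-identityʳ _)
  ∑-δ (suc j) f = trans (+-cong (zeroˡ _) (∑-δ j (f ∘ suc))) (+-identityˡ _)

  ∑∑-upper-triangle : ∀ {n} (f : Fin n → Fin n → Carrier) →
    ∑ A (λ i → ∑ A (λ j → f i j)) ≈
    ∑ A (λ i → ∑ A (λ j → if does (i Fin.≤? j)
                           then (if does (i Fin.≟ j) then f i j else f i j + f j i)
                           else 0#))
  ∑∑-upper-triangle {n} f = begin
    ∑ A (λ i → ∑ A (λ j → f i j))
      ≈⟨ ∑-cong {n} (λ i → ∑-cong {n} (λ j → split (i Fin.≤? j))) ⟩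
    ∑ A (λ i → ∑ A (λ j → U i j + L i j))
      ≈⟨ trans (∑-cong {n} (λ i → ∑-distrib-+ {n} _ _)) (∑-distrib-+ {n} _ _) ⟩
    ∑ A (λ i → ∑ A (λ j → U i j)) + ∑ A (λ i → ∑ A (λ j → L i j))
      ≈⟨ +-congˡ (∑-comm L) ⟩
    ∑ A (λ i → ∑ A (λ j → U i j)) + ∑ A (λ i → ∑ A (λ j → L j i))
      ≈⟨ trans (∑-cong {n} (λ i → ∑-distrib-+ {n} _ _)) (∑-distrib-+ {n} _ _) ⟨
    ∑ A (λ i → ∑ A (λ j → U i j + L j i))
      ≈⟨ ∑-cong {n} (λ i → ∑-cong {n} (λ j → merge i j (i Fin.≤? j) (j Fin.≤? i) (i Fin.≟ j))) ⟩
    ∑ A (λ i → ∑ A (λ j → if does (i Fin.≤? j)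
                           then (if does (i Fin.≟ j) then f i j else f i j + f j i)
                           else 0#)) ∎
    where
    U L : Fin n → Fin n → Carrier
    U i j = if does (i Fin.≤? j) then f i j else 0#
    L i j = if does (i Fin.≤? j) then 0# else f i j
    split : ∀ {i j} (i≤?j : Dec (i Fin.≤ j)) →
            f i j ≈ (if does i≤?j then f i j else 0#) + (if does i≤?j then 0# else f i j)
    split (yes _) = sym (+-identityʳ _)
    split (no _)  = sym (+-identityˡ _)
    merge : ∀ i j (i≤?j : Dec (i Fin.≤ j)) (j≤?i : Dec (j Fin.≤ i)) (i≟j : Dec (i ≡ j)) →
            (if does i≤?j then f i j else 0#) + (if does j≤?i then 0# else f j i) ≈
            (if does i≤?j then (if does i≟j then f i j else f i j + f j i) else 0#)
    merge i j (yes i≤j) (yes j≤i) (no i≢j)  = contradiction (Finₚ.≤-antisym i≤j j≤i) i≢j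
    merge i j (yes i≤j) (no j≰i)  (yes i≡j) = contradiction (Finₚ.≤-reflexive (≡-sym i≡j)) j≰i
    merge i j (yes i≤j) (yes j≤i) (yes i≡j) = +-identityʳ _
    merge i j (yes i≤j) (no j≰i)  (no i≢j)  = refl
    merge i j (no i≰j)  (yes j≤i) i≟j       = +-identityʳ _
    merge i j (no i≰j)  (no j≰i)  i≟j       = contradiction (Finₚ.≤-total i j) [ i≰j , j≰i ]′

module _ {A B : CommutativeRing 0ℓ 0ℓ} where
  private
    module A = CommutativeRing A
    module B = CommutativeRing B

  ∑-homo : ∀ {h} → IsMonoidHomomorphism A.+-rawMonoid B.+-rawMonoid h →
           ∀ {n} (f : Fin n → A.Carrier) → h (∑ A f) B.≈ ∑ B (h ∘ f)
  ∑-homo hom {zero}  f = ε-homo  where open IsMonoidHomomorphism hom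
  ∑-homo hom {suc n} f = B.trans (homo _ _) (B.+-congˡ (∑-homo hom (f ∘ suc)))
    where open IsMonoidHomomorphism hom

  δ-homo : ∀ {h} → IsRingHomomorphism A.rawRing B.rawRing h →
           ∀ {n} (i j : Fin n) → h (δ A i j) B.≈ δ B i j
  δ-homo hom i j with does (i Fin.≟ j)
  ... | true  = IsRingHomomorphism.1#-homo hom
  ... | false = IsRingHomomorphism.0#-homo hom

module AdditiveProperties (A : CommutativeRing 0ℓ 0ℓ) where
  open CommutativeRing A
  open import Algebra.Properties.Ring ring using (-‿+-comm; -‿involutive; +-cancelˡ)
  open import Relation.Binary.Reasoning.Setoid setoid
  open import Algebra.Solver.CommutativeMonoid +-commutativeMonoid using (solve; _⊕_; _⊜_)

  x-[y+z]≈x-y-z : ∀ x y z → x - (y + z) ≈ x - y - z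
  x-[y+z]≈x-y-z x y z = trans (+-congˡ (sym (-‿+-comm y z))) (sym (+-assoc _ _ _))

  [a-b]+[c-d]+[e-f]≈[a+c+e]-[b+d+f] : ∀ a b c d e f →
    (a - b) + (c - d) + (e - f) ≈ (a + c + e) - (b + d + f)
  [a-b]+[c-d]+[e-f]≈[a+c+e]-[b+d+f] a b c d e f = trans
    (solve 6 (λ a b c d e f → ((a ⊕ b) ⊕ (c ⊕ d)) ⊕ (e ⊕ f) ⊜ ((a ⊕ c) ⊕ e) ⊕ ((b ⊕ d) ⊕ f))
           refl a (- b) c (- d) e (- f))
    (+-congˡ (trans (+-congʳ (-‿+-comm b d)) (-‿+-comm (b + d) f)))

  [a-b]-[c-d]≈[a+d]-[b+c] : ∀ a b c d → (a - b) - (c - d) ≈ (a + d) - (b + c)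
  [a-b]-[c-d]≈[a+d]-[b+c] a b c d = begin
    (a - b) - (c - d)     ≈⟨ +-congˡ (sym (-‿+-comm c (- d))) ⟩
    (a - b) + (- c - - d) ≈⟨ +-congˡ (+-congˡ (-‿involutive d)) ⟩
    (a - b) + (- c + d)   ≈⟨ solve 4 (λ a b c d → (a ⊕ b) ⊕ (c ⊕ d) ⊜ (a ⊕ d) ⊕ (b ⊕ c))
                                     refl a (- b) (- c) d ⟩
    (a + d) + (- b - c)   ≈⟨ +-congˡ (-‿+-comm b c) ⟩
    (a + d) - (b + c)     ∎

  x+y+z≈x⇒y+z≈0 : ∀ {x y z} → x + y + z ≈ x → y + z ≈ 0#
  x+y+z≈x⇒y+z≈0 {x} {y} {z} e = +-cancelˡ x (y + z) 0# (trans (sym (+-assoc x y z)) (trans e (sym (+-identityʳ x))))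

  x≈y+z+w⇒x-y-w≈z : ∀ {x y z w} → x ≈ y + z + w → x - y - w ≈ z
  x≈y+z+w⇒x-y-w≈z {x} {y} {z} {w} e = begin
    x - y - w                  ≈⟨ +-congʳ (+-congʳ e) ⟩
    y + z + w - y - w          ≈⟨ solve 5 (λ y z w y′ w′ → (((y ⊕ z) ⊕ w) ⊕ y′) ⊕ w′ ⊜ z ⊕ ((y ⊕ y′) ⊕ (w ⊕ w′)))
                                          refl y z w (- y) (- w) ⟩
    z + ((y - y) + (w - w))    ≈⟨ +-congˡ (+-cong (-‿inverseʳ y) (-‿inverseʳ w)) ⟩
    z + (0# + 0#)              ≈⟨ trans (+-congˡ (+-identityˡ 0#)) (+-identityʳ z) ⟩
    z                          ∎

  [_,_] : (Carrier → Carrier) → (Carrier → Carrier) → Carrier → Carrier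
  [ P , Q ] x = P (Q x) - Q (P x)

  [[,],]-jacobi : ∀ P Q S →
    (∀ x y → P (x - y) ≈ P x - P y) → (∀ x y → Q (x - y) ≈ Q x - Q y) →
    (∀ x y → S (x - y) ≈ S x - S y) →
    ∀ x → [ [ P , Q ] , S ] x + [ [ S , P ] , Q ] x + [ [ Q , S ] , P ] x ≈ 0#
  [[,],]-jacobi P Q S P-‿ Q-‿ S-‿ x = begin
    [ [ P , Q ] , S ] x + [ [ S , P ] , Q ] x + [ [ Q , S ] , P ] x
      ≈⟨ +-cong (+-cong (expand P Q S S-‿) (expand S P Q Q-‿)) (expand Q S P P-‿) ⟩
    (PQS + SQP) - (QPS + SPQ) + ((SPQ + QPS) - (PSQ + QSP)) + ((QSP + PSQ) - (SQP + PQS))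
      ≈⟨ [a-b]+[c-d]+[e-f]≈[a+c+e]-[b+d+f] _ _ _ _ _ _ ⟩
    ((PQS + SQP) + (SPQ + QPS) + (QSP + PSQ)) - ((QPS + SPQ) + (PSQ + QSP) + (SQP + PQS))
      ≈⟨ +-congʳ (solve 6 (λ a b c d e f → ((a ⊕ b) ⊕ (c ⊕ d)) ⊕ (e ⊕ f) ⊜ ((d ⊕ c) ⊕ (f ⊕ e)) ⊕ (b ⊕ a))
                        refl PQS SQP SPQ QPS QSP PSQ) ⟩
    ((QPS + SPQ) + (PSQ + QSP) + (SQP + PQS)) - ((QPS + SPQ) + (PSQ + QSP) + (SQP + PQS))
      ≈⟨ -‿inverseʳ _ ⟩
    0# ∎
    where
    PQS = P (Q (S x)); SQP = S (Q (P x)); QPS = Q (P (S x))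
    SPQ = S (P (Q x)); PSQ = P (S (Q x)); QSP = Q (S (P x))
    expand : ∀ P Q S → (∀ x y → S (x - y) ≈ S x - S y) →
             [ [ P , Q ] , S ] x ≈ (P (Q (S x)) + S (Q (P x))) - (Q (P (S x)) + S (P (Q x)))
    expand P Q S S-‿ = trans (+-congˡ (-‿cong (S-‿ _ _))) ([a-b]-[c-d]≈[a+d]-[b+c] _ _ _ _)

module DΓRingProperties {k : Field} {D₁ D₂ : LocalOpSystem k} {𝔽 : DField k D₁ D₂}
                        {Γ : LHSCommSystem 𝔽} (ℛ : DΓRing Γ) where
  private
    module K = Field k
    module 𝔽 = DField 𝔽
    module F = Field 𝔽.F
    module Γ = LHSCommSystem Γ
    module F∑ = SumProperties F.commRing
  open DΓRing ℛ
  private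
    module R = CommutativeRing R
    module Rₚ = Algebra.Properties.Ring R.ring
    module ιR = IsRingHomomorphism ιR-hom
    ∑R = ∑ R
    ∑F = ∑ F.commRing
  open SumProperties R
  open AdditiveProperties R
  open import Relation.Binary.Reasoning.Setoid R.setoid

  φ : K.Carrier → R.Carrier
  φ = ιR ∘ 𝔽.ι

  φ-isRingHomomorphism : IsRingHomomorphism K.rawRing R.rawRing φ
  φ-isRingHomomorphism = isRingHomomorphism R.trans 𝔽.ι-hom ιR-hom

  ιR-∑ : ∀ {n} (f : Fin n → F.Carrier) → ιR (∑F f) R.≈ ∑R (ιR ∘ f)
  ιR-∑ = ∑-homo {F.commRing} {R} ιR.+-isMonoidHomomorphism

  lc : ∀ {n} → (Fin n → F.Carrier) → (Fin n → R.Carrier) → R.Carrier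
  lc u g = ∑R (λ ℓ → ιR (u ℓ) R.* g ℓ)

  lc² : ∀ {a b} → (Fin a → Fin b → F.Carrier) → (Fin a → Fin b → R.Carrier) → R.Carrier
  lc² A G = ∑R (λ q → lc (A q) (G q))

  lc-cong : ∀ {n} {u v : Fin n → F.Carrier} {g h : Fin n → R.Carrier} →
            (∀ i → u i F.≈ v i) → (∀ i → g i R.≈ h i) → lc u g R.≈ lc v h
  lc-cong {n} u≈v g≈h = ∑-cong {n} (λ i → R.*-cong (ιR.⟦⟧-cong (u≈v i)) (g≈h i))

  lc-congʳ : ∀ {n} (u : Fin n → F.Carrier) {g h : Fin n → R.Carrier} →
             (∀ i → g i R.≈ h i) → lc u g R.≈ lc u h
  lc-congʳ u = lc-cong (λ _ → F.refl)

  lc-zero : ∀ {n} {u : Fin n → F.Carrier} (g : Fin n → R.Carrier) →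
            (∀ i → u i F.≈ F.0#) → lc u g R.≈ R.0#
  lc-zero {n} g u≈0 =
    ∑-zero {n} (λ i → R.trans (R.*-congʳ (R.trans (ιR.⟦⟧-cong (u≈0 i)) ιR.0#-homo)) (R.zeroˡ _))

  lc-distribˡ-+ : ∀ {n} (u v : Fin n → F.Carrier) g →
                  lc (λ i → u i F.+ v i) g R.≈ lc u g R.+ lc v g
  lc-distribˡ-+ {n} u v g =
    R.trans (∑-cong {n} (λ i → R.trans (R.*-congʳ (ιR.+-homo _ _)) (R.distribʳ _ _ _))) (∑-distrib-+ {n} _ _)

  lc-distribˡ-‿ : ∀ {n} (u : Fin n → F.Carrier) g → lc (λ i → F.- u i) g R.≈ R.- lc u g
  lc-distribˡ-‿ {n} u g = R.trans
    (∑-cong {n} (λ i → R.trans (R.*-congʳ (ιR.-‿homo _)) (R.sym (Rₚ.-‿distribˡ-* _ _))))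
    (R.sym (-‿distrib-∑ {n} _))

  lc-distribˡ-- : ∀ {n} (u v : Fin n → F.Carrier) g →
                  lc (λ i → u i F.- v i) g R.≈ lc u g R.- lc v g
  lc-distribˡ-- u v g = R.trans (lc-distribˡ-+ u _ g) (R.+-congˡ (lc-distribˡ-‿ v g))

  lc-distribʳ-- : ∀ {n} (u : Fin n → F.Carrier) g h →
                  lc u (λ i → g i R.- h i) R.≈ lc u g R.- lc u h
  lc-distribʳ-- {n} u g h = R.sym (begin
    lc u g R.- lc u h                                ≈⟨ R.+-congˡ (-‿distrib-∑ {n} _) ⟩
    lc u g R.+ ∑R (λ i → R.- (ιR (u i) R.* h i))     ≈⟨ ∑-distrib-+ {n} _ _ ⟨
    ∑R (λ i → ιR (u i) R.* g i R.- ιR (u i) R.* h i) ≈⟨ ∑-cong {n} (λ i → Rₚ.x[y-z]≈xy-xz _ _ _) ⟨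
    lc u (λ i → g i R.- h i)                         ∎)

  ιR-*-lc : ∀ {n} a (u : Fin n → F.Carrier) g → ιR a R.* lc u g R.≈ lc (λ i → a F.* u i) g
  ιR-*-lc {n} a u g = R.trans (*-distribˡ-sum {n} _ _)
    (∑-cong {n} (λ i → R.trans (R.sym (R.*-assoc _ _ _)) (R.*-congʳ (R.sym (ιR.*-homo _ _)))))

  ∑-lc : ∀ {a n} (u : Fin a → Fin n → F.Carrier) g →
         ∑R (λ q → lc (u q) g) R.≈ lc (λ s → ∑F (λ q → u q s)) g
  ∑-lc {a} {n} u g = R.trans (∑-comm (λ q s → ιR (u q s) R.* g s)) (∑-cong {n} (λ s →
    R.trans (R.sym (*-distribʳ-sum {a} _ _)) (R.*-congʳ (R.sym (ιR-∑ {a} _)))))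

  lc-lc : ∀ {a n} (u : Fin a → F.Carrier) (v : Fin a → Fin n → F.Carrier) g →
          lc u (λ ℓ → lc (v ℓ) g) R.≈ lc (λ s → ∑F (λ ℓ → u ℓ F.* v ℓ s)) g
  lc-lc {a} u v g = R.trans (∑-cong {a} (λ ℓ → ιR-*-lc (u ℓ) (v ℓ) g)) (∑-lc (λ ℓ s → u ℓ F.* v ℓ s) g)

  ∑∑-φ-collect : ∀ {a b : ℕ} (κ : Fin a → Fin b → K.Carrier) (v : Fin a → F.Carrier)
                 (Z : Fin b → R.Carrier) →
    ∑R (λ p → ∑R (λ q → φ (κ p q) R.* ιR (v p) R.* Z q)) R.≈
    lc (λ q → ∑F (λ p → 𝔽.ι (κ p q) F.* v p)) Z
  ∑∑-φ-collect {a} {b} κ v Z = R.trans (∑-comm (λ p q → φ (κ p q) R.* ιR (v p) R.* Z q)) (∑-cong {b} (λ q →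
    begin
    ∑R (λ p → φ (κ p q) R.* ιR (v p) R.* Z q)    ≈⟨ ∑-cong {a} (λ p → R.*-congʳ (ιR.*-homo _ _)) ⟨
    ∑R (λ p → ιR (𝔽.ι (κ p q) F.* v p) R.* Z q)  ≈⟨ *-distribʳ-sum {a} _ _ ⟨
    ∑R (λ p → ιR (𝔽.ι (κ p q) F.* v p)) R.* Z q  ≈⟨ R.*-congʳ (ιR-∑ {a} _) ⟨
    ιR (∑F (λ p → 𝔽.ι (κ p q) F.* v p)) R.* Z q  ∎))

  lc²-zero : ∀ {a b} {A : Fin a → Fin b → F.Carrier} G → (∀ q ℓ → A q ℓ F.≈ F.0#) → lc² A G R.≈ R.0#
  lc²-zero {a} G A≈0 = ∑-zero {a} (λ q → lc-zero (G q) (A≈0 q))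

  lc²-distribˡ-+ : ∀ {a b} (A B : Fin a → Fin b → F.Carrier) G →
                   lc² (λ q ℓ → A q ℓ F.+ B q ℓ) G R.≈ lc² A G R.+ lc² B G
  lc²-distribˡ-+ {a} A B G = R.trans (∑-cong {a} (λ q → lc-distribˡ-+ (A q) (B q) (G q))) (∑-distrib-+ {a} _ _)

  lc²-transpose : ∀ {a b} (A : Fin a → Fin b → F.Carrier) G →
                  lc² A G R.≈ lc² (λ ℓ q → A q ℓ) (λ ℓ q → G q ℓ)
  lc²-transpose A G = ∑-comm (λ q ℓ → ιR (A q ℓ) R.* G q ℓ)

  lc²-lc : ∀ {a b n} (A : Fin a → Fin b → F.Carrier) (C : Fin a → Fin b → Fin n → F.Carrier) g →
           lc² A (λ q ℓ → lc (C q ℓ) g) R.≈ lc (λ s → ∑F (λ q → ∑F (λ ℓ → A q ℓ F.* C q ℓ s))) g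
  lc²-lc {a} A C g =
    R.trans (∑-cong {a} (λ q → lc-lc (A q) (C q) g)) (∑-lc (λ q s → ∑F (λ ℓ → A q ℓ F.* C q ℓ s)) g)

  module Leibniz (D : LocalOpSystem k)
                 (∂ : Fin (LocalOpSystem.m D) → R.Carrier → R.Carrier)
                 (isD : DStr.IsDStructure k D R φ ∂)
                 (∂F : Fin (LocalOpSystem.m D) → F.Carrier → F.Carrier)
                 (ιR-∂ : ∀ i f → ∂ i (ιR f) R.≈ ιR (∂F i f)) where
    open LocalOpSystem D using (m; α; isLocalOpSystem)
    open OpSys.IsLocalOpSystem isLocalOpSystem using (unitˡ; comm)
    open DStr.IsDStructure isD using (∂-+; ∂-scalar; e-*)
    open DStr.IsDStructure isD public using (∂-cong)
    private
      module φ = IsRingHomomorphism φ-isRingHomomorphism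
      module ι = IsRingHomomorphism 𝔽.ι-hom

    -- the coefficient of ∂_q y in ∂_c (f y) contributed by the products ε_p ε_q
    cross : Fin m → F.Carrier → Fin m → F.Carrier
    cross c f q = ∑F (λ p → 𝔽.ι (α (suc p) (suc q) (suc c)) F.* ∂F p f)

    cross-annihilated : ∀ c f q → (∀ p x → α (suc q) (suc p) x K.≈ K.0#) → cross c f q F.≈ F.0#
    cross-annihilated c f q εq𝔪≈0 = F∑.∑-zero {m} (λ p →
      F.trans (F.*-congʳ (F.trans (ι.⟦⟧-cong (K.trans (comm _ _ _) (εq𝔪≈0 p (suc c)))) ι.0#-homo)) (F.zeroˡ _))

    ∂-isMonoidHomomorphism : ∀ c → IsMonoidHomomorphism R.+-rawMonoid R.+-rawMonoid (∂ c)
    ∂-isMonoidHomomorphism c = record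
      { isMagmaHomomorphism = record
        { isRelHomomorphism = record { cong = ∂-cong c }
        ; homo = ∂-+ c
        }
      ; ε-homo = R.trans (∂-cong c (R.sym φ.0#-homo)) (∂-scalar c K.0#)
      }

    ∂-∑ : ∀ c {n} (g : Fin n → R.Carrier) → ∂ c (∑R g) R.≈ ∑R (∂ c ∘ g)
    ∂-∑ c = ∑-homo {R} {R} (∂-isMonoidHomomorphism c)

    ∂-‿ : ∀ c x y → ∂ c (x R.- y) R.≈ ∂ c x R.- ∂ c y
    ∂-‿ c x y = begin
      ∂ c (x R.- y)                       ≈⟨ Rₚ.//-rightDividesʳ (∂ c y) _ ⟨
      ∂ c (x R.- y) R.+ ∂ c y R.- ∂ c y   ≈⟨ R.+-congʳ (∂-+ c _ _) ⟨
      ∂ c (x R.- y R.+ y) R.- ∂ c y       ≈⟨ R.+-congʳ (∂-cong c (Rₚ.//-rightDividesˡ y x)) ⟩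
      ∂ c x R.- ∂ c y                     ∎

    φ-unitˡ : ∀ q i → φ (α zero q i) R.≈ δ R q i
    φ-unitˡ q i = R.trans (φ.⟦⟧-cong (unitˡ q i)) (δ-homo {K.commRing} {R} φ-isRingHomomorphism q i)

    leibniz : ∀ c f y → ∂ c (ιR f R.* y) R.≈
              ιR f R.* ∂ c y R.+ ιR (∂F c f) R.* y R.+ lc (cross c f) (λ q → ∂ q y)
    leibniz c f y = begin
      ∂ c (ιR f R.* y)
        ≈⟨ e-* (suc c) (ιR f) y ⟩
      (φ (α zero zero (suc c)) R.* ιR f R.* y R.+
         ∑R (λ q → φ (α zero (suc q) (suc c)) R.* ιR f R.* ∂ q y)) R.+
      ∑R (λ p → φ (α (suc p) zero (suc c)) R.* ∂ p (ιR f) R.* y R.+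
         ∑R (λ q → φ (α (suc p) (suc q) (suc c)) R.* ∂ p (ιR f) R.* ∂ q y))
        ≈⟨ R.+-cong (R.+-cong f-y f-∂y) (R.trans (∑-distrib-+ {m} _ _) (R.+-cong ∂f-y ∂f-∂y)) ⟩
      (R.0# R.+ ιR f R.* ∂ c y) R.+ (ιR (∂F c f) R.* y R.+ lc (cross c f) (λ q → ∂ q y))
        ≈⟨ R.trans (R.+-congʳ (R.+-identityˡ _)) (R.sym (R.+-assoc _ _ _)) ⟩
      ιR f R.* ∂ c y R.+ ιR (∂F c f) R.* y R.+ lc (cross c f) (λ q → ∂ q y) ∎
      where
      f-y : φ (α zero zero (suc c)) R.* ιR f R.* y R.≈ R.0#
      f-y = R.trans (R.*-congʳ (R.trans (R.*-congʳ (φ-unitˡ zero (suc c))) (R.zeroˡ _))) (R.zeroˡ _)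
      f-∂y : ∑R (λ q → φ (α zero (suc q) (suc c)) R.* ιR f R.* ∂ q y) R.≈ ιR f R.* ∂ c y
      f-∂y = R.trans (∑-cong {m} (λ q → R.trans (R.*-assoc _ _ _) (R.*-congʳ (φ-unitˡ (suc q) (suc c)))))
                     (∑-δ c (λ q → ιR f R.* ∂ q y))
      ∂f-y : ∑R (λ p → φ (α (suc p) zero (suc c)) R.* ∂ p (ιR f) R.* y) R.≈ ιR (∂F c f) R.* y
      ∂f-y = R.trans (∑-cong {m} (λ p → R.trans (R.*-assoc _ _ _)
                       (R.*-cong (R.trans (φ.⟦⟧-cong (comm _ _ _)) (φ-unitˡ (suc p) (suc c)))
                                 (R.*-congʳ (ιR-∂ p f)))))
                     (∑-δ c (λ p → ιR (∂F p f) R.* y))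
      ∂f-∂y : ∑R (λ p → ∑R (λ q → φ (α (suc p) (suc q) (suc c)) R.* ∂ p (ιR f) R.* ∂ q y)) R.≈
              lc (cross c f) (λ q → ∂ q y)
      ∂f-∂y = R.trans (∑-cong {m} (λ p → ∑-cong {m} (λ q → R.*-congʳ (R.*-congˡ (ιR-∂ p f)))))
                      (∑∑-φ-collect (λ p q → α (suc p) (suc q) (suc c)) (λ p → ∂F p f) (λ q → ∂ q y))

    ∂-lc : ∀ c {n} (u : Fin n → F.Carrier) g → ∂ c (lc u g) R.≈
           lc u (λ ℓ → ∂ c (g ℓ)) R.+ lc (λ ℓ → ∂F c (u ℓ)) g R.+
           lc² (λ q ℓ → cross c (u ℓ) q) (λ q ℓ → ∂ q (g ℓ))
    ∂-lc c {n} u g = begin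
      ∂ c (lc u g)
        ≈⟨ ∂-∑ c {n} _ ⟩
      ∑R (λ ℓ → ∂ c (ιR (u ℓ) R.* g ℓ))
        ≈⟨ ∑-cong {n} (λ ℓ → leibniz c (u ℓ) (g ℓ)) ⟩
      ∑R (λ ℓ → ιR (u ℓ) R.* ∂ c (g ℓ) R.+ ιR (∂F c (u ℓ)) R.* g ℓ R.+
                lc (cross c (u ℓ)) (λ q → ∂ q (g ℓ)))
        ≈⟨ R.trans (∑-distrib-+ {n} _ _) (R.+-congʳ (∑-distrib-+ {n} _ _)) ⟩
      lc u (λ ℓ → ∂ c (g ℓ)) R.+ lc (λ ℓ → ∂F c (u ℓ)) g R.+
      ∑R (λ ℓ → lc (cross c (u ℓ)) (λ q → ∂ q (g ℓ)))
        ≈⟨ R.+-congˡ (∑-comm (λ ℓ q → ιR (cross c (u ℓ) q) R.* ∂ q (g ℓ))) ⟩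
      lc u (λ ℓ → ∂ c (g ℓ)) R.+ lc (λ ℓ → ∂F c (u ℓ)) g R.+
      lc² (λ q ℓ → cross c (u ℓ) q) (λ q ℓ → ∂ q (g ℓ)) ∎

    ∂-commuting-relation : ∀ c {n} (T : R.Carrier → R.Carrier) (u : Fin n → F.Carrier)
      (P : Fin n → R.Carrier → R.Carrier) → (∀ x → T x R.≈ lc u (λ ℓ → P ℓ x)) →
      (∀ x → ∂ c (T x) R.≈ T (∂ c x)) → (∀ ℓ x → ∂ c (P ℓ x) R.≈ P ℓ (∂ c x)) →
      ∀ x → lc (λ ℓ → ∂F c (u ℓ)) (λ ℓ → P ℓ x) R.+
            lc² (λ q ℓ → cross c (u ℓ) q) (λ q ℓ → ∂ q (P ℓ x)) R.≈ R.0#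
    ∂-commuting-relation c T u P T≈lc ∂T≈T∂ ∂P≈P∂ x = x+y+z≈x⇒y+z≈0 (begin
      lc u (λ ℓ → ∂ c (P ℓ x)) R.+ lc (λ ℓ → ∂F c (u ℓ)) (λ ℓ → P ℓ x) R.+
      lc² (λ q ℓ → cross c (u ℓ) q) (λ q ℓ → ∂ q (P ℓ x))
                                 ≈⟨ ∂-lc c u (λ ℓ → P ℓ x) ⟨
      ∂ c (lc u (λ ℓ → P ℓ x))   ≈⟨ ∂-cong c (T≈lc x) ⟨
      ∂ c (T x)                  ≈⟨ ∂T≈T∂ x ⟩
      T (∂ c x)                  ≈⟨ T≈lc (∂ c x) ⟩
      lc u (λ ℓ → P ℓ (∂ c x))   ≈⟨ lc-congʳ u (λ ℓ → ∂P≈P∂ ℓ x) ⟨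
      lc u (λ ℓ → ∂ c (P ℓ x))   ∎)

  private
    m₁ = LocalOpSystem.m D₁
    m₂ = LocalOpSystem.m D₂
    α₂ = LocalOpSystem.α D₂
    c₁ = Γ.c₁
    c₂ = Γ.c₂

  module L₁ = Leibniz D₁ ∂₁ isD₁ 𝔽.∂₁ ιR-∂₁
  module L₂ = Leibniz D₂ ∂₂ isD₂ 𝔽.∂₂ ιR-∂₂
  open L₁ public using () renaming (cross to cross₁)
  open L₂ public using () renaming (cross to cross₂)

  ∂₁-of-comm₂ : ∀ k′ i j x →
    lc (λ ℓ → 𝔽.∂₁ k′ (c₂ i j ℓ)) (λ ℓ → ∂₂ ℓ x) R.+
    lc² (λ q ℓ → cross₁ k′ (c₂ i j ℓ) q) (λ q ℓ → ∂₁ q (∂₂ ℓ x)) R.≈ R.0#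
  ∂₁-of-comm₂ k′ i j = L₁.∂-commuting-relation k′ (∂₂ i ∘ ∂₂ j) (c₂ i j) ∂₂ (comm₂ i j)
    (λ x → R.trans (comm₁₂ k′ i _) (L₂.∂-cong i (comm₁₂ k′ j x)))
    (comm₁₂ k′)

  ∂₂-of-comm₁ : ∀ k′ i j x →
    lc (λ ℓ → 𝔽.∂₂ k′ (c₁ i j ℓ)) (λ ℓ → ∂₁ ℓ x) R.+
    lc² (λ ℓ q → cross₂ k′ (c₁ i j ℓ) q) (λ ℓ q → ∂₁ ℓ (∂₂ q x)) R.≈ R.0#
  ∂₂-of-comm₁ k′ i j x = R.trans
    (R.+-congˡ (R.trans (∑-cong {m₁} (λ ℓ → lc-congʳ _ (λ q → comm₁₂ ℓ q x)))
                        (lc²-transpose (λ ℓ q → cross₂ k′ (c₁ i j ℓ) q) _)))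
    (L₂.∂-commuting-relation k′ [ ∂₁ i , ∂₁ j ] (c₁ i j) ∂₁ (comm₁ i j) ∂₂[∂₁,∂₁]
                               (λ ℓ y → R.sym (comm₁₂ ℓ k′ y)) x)
    where
    ∂₂∂₁∂₁ : ∀ a b y → ∂₂ k′ (∂₁ a (∂₁ b y)) R.≈ ∂₁ a (∂₁ b (∂₂ k′ y))
    ∂₂∂₁∂₁ a b y = R.trans (R.sym (comm₁₂ a k′ _)) (L₁.∂-cong a (R.sym (comm₁₂ b k′ y)))
    ∂₂[∂₁,∂₁] : ∀ y → ∂₂ k′ ([ ∂₁ i , ∂₁ j ] y) R.≈ [ ∂₁ i , ∂₁ j ] (∂₂ k′ y)
    ∂₂[∂₁,∂₁] y = R.trans (L₂.∂-‿ k′ _ _) (R.+-cong (∂₂∂₁∂₁ i j y) (R.-‿cong (∂₂∂₁∂₁ j i y)))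

  c₁-antisymmetric : ∀ i j x →
    lc (c₁ i j) (λ ℓ → ∂₁ ℓ x) R.≈ lc (λ ℓ → F.- c₁ j i ℓ) (λ ℓ → ∂₁ ℓ x)
  c₁-antisymmetric i j x = begin
    lc (c₁ i j) (λ ℓ → ∂₁ ℓ x)             ≈⟨ comm₁ i j x ⟨
    [ ∂₁ i , ∂₁ j ] x                      ≈⟨ Rₚ.⁻¹-anti-homo‿- _ _ ⟨
    R.- [ ∂₁ j , ∂₁ i ] x                  ≈⟨ R.-‿cong (comm₁ j i x) ⟩
    R.- lc (c₁ j i) (λ ℓ → ∂₁ ℓ x)         ≈⟨ lc-distribˡ-‿ (c₁ j i) _ ⟨
    lc (λ ℓ → F.- c₁ j i ℓ) (λ ℓ → ∂₁ ℓ x) ∎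

  c₂-associative : ∀ i j k′ x →
    lc (λ s → ∑F (λ ℓ → c₂ i j ℓ F.* c₂ ℓ k′ s F.- c₂ j k′ ℓ F.* c₂ i ℓ s
                F.- ∑F (λ p → ∑F (λ q →
                      𝔽.ι (α₂ (suc p) (suc q) (suc i)) F.* 𝔽.∂₂ p (c₂ j k′ ℓ) F.* c₂ q ℓ s))))
       (λ s → ∂₂ s x)
    R.≈ lc (λ s → 𝔽.∂₂ i (c₂ j k′ s)) (λ s → ∂₂ s x)
  c₂-associative i j k′ x = begin
    lc (λ s → ∑F (λ ℓ → c₂ i j ℓ F.* c₂ ℓ k′ s F.- c₂ j k′ ℓ F.* c₂ i ℓ s F.- W s ℓ)) g
      ≈⟨ lc-cong (λ s → F.trans (F∑.∑-distrib-- {m₂} _ _)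
                          (F.+-cong (F∑.∑-distrib-- {m₂} _ _) (F.-‿cong (F.sym (V≈∑W s)))))
                 (λ _ → R.refl) ⟩
    lc (λ s → X s F.- Y s F.- V s) g
      ≈⟨ R.trans (lc-distribˡ-- _ V g) (R.+-congʳ (lc-distribˡ-- X Y g)) ⟩
    lc X g R.- lc Y g R.- lc V g
      ≈⟨ x≈y+z+w⇒x-y-w≈z (R.trans (R.sym ∂∂∂≈X) ∂∂∂≈Y+Z+V) ⟩
    lc Z g ∎
    where
    g = λ s → ∂₂ s x
    A : Fin m₂ → Fin m₂ → F.Carrier
    A q ℓ = cross₂ i (c₂ j k′ ℓ) q
    X Y Z V : Fin m₂ → F.Carrier
    X s = ∑F (λ ℓ → c₂ i j ℓ F.* c₂ ℓ k′ s)
    Y s = ∑F (λ ℓ → c₂ j k′ ℓ F.* c₂ i ℓ s)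
    Z s = 𝔽.∂₂ i (c₂ j k′ s)
    V s = ∑F (λ q → ∑F (λ ℓ → A q ℓ F.* c₂ q ℓ s))
    w : Fin m₂ → Fin m₂ → Fin m₂ → Fin m₂ → F.Carrier
    w s ℓ p q = 𝔽.ι (α₂ (suc p) (suc q) (suc i)) F.* 𝔽.∂₂ p (c₂ j k′ ℓ) F.* c₂ q ℓ s
    W : Fin m₂ → Fin m₂ → F.Carrier
    W s ℓ = ∑F (λ p → ∑F (λ q → w s ℓ p q))
    V≈∑W : ∀ s → V s F.≈ ∑F (W s)
    V≈∑W s = F.trans (F∑.∑-cong {m₂} (λ q → F∑.∑-cong {m₂} (λ ℓ → F∑.*-distribʳ-sum {m₂} _ _)))
             (F.trans (F∑.∑-comm (λ q ℓ → ∑F (λ p → w s ℓ p q)))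
                      (F∑.∑-cong {m₂} (λ ℓ → F∑.∑-comm (λ q p → w s ℓ p q))))
    ∂∂∂≈X : ∂₂ i (∂₂ j (∂₂ k′ x)) R.≈ lc X g
    ∂∂∂≈X = begin
      ∂₂ i (∂₂ j (∂₂ k′ x))                     ≈⟨ comm₂ i j _ ⟩
      lc (c₂ i j) (λ ℓ → ∂₂ ℓ (∂₂ k′ x))        ≈⟨ lc-congʳ (c₂ i j) (λ ℓ → comm₂ ℓ k′ x) ⟩
      lc (c₂ i j) (λ ℓ → lc (λ s → c₂ ℓ k′ s) g) ≈⟨ lc-lc (c₂ i j) (λ ℓ s → c₂ ℓ k′ s) g ⟩
      lc X g                                    ∎
    ∂∂∂≈Y+Z+V : ∂₂ i (∂₂ j (∂₂ k′ x)) R.≈ lc Y g R.+ lc Z g R.+ lc V g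
    ∂∂∂≈Y+Z+V = begin
      ∂₂ i (∂₂ j (∂₂ k′ x))
        ≈⟨ L₂.∂-cong i (comm₂ j k′ x) ⟩
      ∂₂ i (lc (c₂ j k′) g)
        ≈⟨ L₂.∂-lc i (c₂ j k′) g ⟩
      lc (c₂ j k′) (λ ℓ → ∂₂ i (∂₂ ℓ x)) R.+ lc Z g R.+ lc² A (λ q ℓ → ∂₂ q (∂₂ ℓ x))
        ≈⟨ R.+-cong (R.+-congʳ (R.trans (lc-congʳ (c₂ j k′) (λ ℓ → comm₂ i ℓ x))
                                        (lc-lc (c₂ j k′) (c₂ i) g)))
                    (R.trans (∑-cong {m₂} (λ q → lc-congʳ (A q) (λ ℓ → comm₂ q ℓ x)))
                             (lc²-lc A c₂ g)) ⟩
      lc Y g R.+ lc Z g R.+ lc V g ∎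

  c₁c₁-∂₁c₁ : Fin m₁ → Fin m₁ → Fin m₁ → Fin m₁ → F.Carrier
  c₁c₁-∂₁c₁ a b t s = ∑F (λ ℓ → c₁ a b ℓ F.* c₁ ℓ t s) F.- 𝔽.∂₁ t (c₁ a b s)

  [[∂₁,∂₁],∂₁]-expansion : ∀ a b t x → [ [ ∂₁ a , ∂₁ b ] , ∂₁ t ] x R.≈
    lc (c₁c₁-∂₁c₁ a b t) (λ s → ∂₁ s x) R.-
    lc² (λ q ℓ → cross₁ t (c₁ a b ℓ) q) (λ q ℓ → ∂₁ q (∂₁ ℓ x))
  [[∂₁,∂₁],∂₁]-expansion a b t x = begin
    [ ∂₁ a , ∂₁ b ] (∂₁ t x) R.- ∂₁ t ([ ∂₁ a , ∂₁ b ] x)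
      ≈⟨ R.+-cong (comm₁ a b (∂₁ t x))
                  (R.-‿cong (R.trans (L₁.∂-cong t (comm₁ a b x)) (L₁.∂-lc t (c₁ a b) g))) ⟩
    lc (c₁ a b) (λ ℓ → ∂₁ ℓ (∂₁ t x)) R.-
    (lc (c₁ a b) (λ ℓ → ∂₁ t (∂₁ ℓ x)) R.+ lc ∂c g R.+ second)
      ≈⟨ R.trans (x-[y+z]≈x-y-z _ _ _) (R.+-congʳ (x-[y+z]≈x-y-z _ _ _)) ⟩
    lc (c₁ a b) (λ ℓ → ∂₁ ℓ (∂₁ t x)) R.- lc (c₁ a b) (λ ℓ → ∂₁ t (∂₁ ℓ x)) R.-
    lc ∂c g R.- second
      ≈⟨ R.+-congʳ (R.+-congʳ (R.trans (R.sym (lc-distribʳ-- (c₁ a b) _ _))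
                                        (R.trans (lc-congʳ (c₁ a b) (λ ℓ → comm₁ ℓ t x))
                                                 (lc-lc (c₁ a b) (λ ℓ → c₁ ℓ t) g)))) ⟩
    lc cc g R.- lc ∂c g R.- second
      ≈⟨ R.+-congʳ (lc-distribˡ-- cc ∂c g) ⟨
    lc (c₁c₁-∂₁c₁ a b t) g R.- second ∎
    where
    g = λ s → ∂₁ s x
    cc ∂c : Fin m₁ → F.Carrier
    cc s = ∑F (λ ℓ → c₁ a b ℓ F.* c₁ ℓ t s)
    ∂c s = 𝔽.∂₁ t (c₁ a b s)
    second = lc² (λ q ℓ → cross₁ t (c₁ a b ℓ) q) (λ q ℓ → ∂₁ q (∂₁ ℓ x))

  -- first- and second-order coefficients of [[∂j,∂k],∂i] + [[∂i,∂j],∂k] + [[∂k,∂i],∂j]; this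
  -- cyclic order is the one in which conditions (b) and (c) list their terms
  jacobiator¹ : Fin m₁ → Fin m₁ → Fin m₁ → Fin m₁ → F.Carrier
  jacobiator¹ i j k′ s = c₁c₁-∂₁c₁ j k′ i s F.+ c₁c₁-∂₁c₁ i j k′ s F.+ c₁c₁-∂₁c₁ k′ i j s

  jacobiator² : Fin m₁ → Fin m₁ → Fin m₁ → Fin m₁ → Fin m₁ → F.Carrier
  jacobiator² i j k′ q ℓ =
    cross₁ i (c₁ j k′ ℓ) q F.+ cross₁ k′ (c₁ i j ℓ) q F.+ cross₁ j (c₁ k′ i ℓ) q

  jacobi-identity : ∀ i j k′ x →
    lc (jacobiator¹ i j k′) (λ s → ∂₁ s x) R.≈ lc² (jacobiator² i j k′) (λ q ℓ → ∂₁ q (∂₁ ℓ x))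
  jacobi-identity i j k′ x = Rₚ.x∙y⁻¹≈ε⇒x≈y _ _ (begin
    lc (jacobiator¹ i j k′) g R.- lc² (jacobiator² i j k′) G
      ≈⟨ R.+-cong (R.trans (lc-distribˡ-+ _ (P k′ i j) g)
                           (R.+-congʳ (lc-distribˡ-+ (P j k′ i) (P i j k′) g)))
                  (R.-‿cong (R.trans (lc²-distribˡ-+ _ (A k′ i j) G)
                                     (R.+-congʳ (lc²-distribˡ-+ (A j k′ i) (A i j k′) G)))) ⟩
    (lc (P j k′ i) g R.+ lc (P i j k′) g R.+ lc (P k′ i j) g) R.-
    (lc² (A j k′ i) G R.+ lc² (A i j k′) G R.+ lc² (A k′ i j) G)
      ≈⟨ [a-b]+[c-d]+[e-f]≈[a+c+e]-[b+d+f] _ _ _ _ _ _ ⟨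
    (lc (P j k′ i) g R.- lc² (A j k′ i) G) R.+ (lc (P i j k′) g R.- lc² (A i j k′) G) R.+
    (lc (P k′ i j) g R.- lc² (A k′ i j) G)
      ≈⟨ R.+-cong (R.+-cong ([[∂₁,∂₁],∂₁]-expansion j k′ i x) ([[∂₁,∂₁],∂₁]-expansion i j k′ x))
                  ([[∂₁,∂₁],∂₁]-expansion k′ i j x) ⟨
    [ [ ∂₁ j , ∂₁ k′ ] , ∂₁ i ] x R.+ [ [ ∂₁ i , ∂₁ j ] , ∂₁ k′ ] x R.+
    [ [ ∂₁ k′ , ∂₁ i ] , ∂₁ j ] x
      ≈⟨ [[,],]-jacobi (∂₁ j) (∂₁ k′) (∂₁ i) (L₁.∂-‿ j) (L₁.∂-‿ k′) (L₁.∂-‿ i) x ⟩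
    R.0# ∎)
    where
    g = λ s → ∂₁ s x
    G = λ q ℓ → ∂₁ q (∂₁ ℓ x)
    P = c₁c₁-∂₁c₁
    A : Fin m₁ → Fin m₁ → Fin m₁ → Fin m₁ → Fin m₁ → F.Carrier
    A a b t q ℓ = cross₁ t (c₁ a b ℓ) q

  -- the second-order part of `Independent`: only ∂₁ i ∂₁ j with i ≤ j occur
  ordered : (Fin m₁ → Fin m₁ → F.Carrier) → R.Carrier → R.Carrier
  ordered b x = ∑R (λ i → ∑R (λ j → if does (i Fin.≤? j) then ιR (b i j) R.* ∂₁ i (∂₁ j x) else R.0#))

  symmetrize : ∀ {n} → (Fin n → Fin n → F.Carrier) → Fin n → Fin n → F.Carrier
  symmetrize A i j = if does (i Fin.≟ j) then A i j else A i j F.+ A j i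

  ordered-zero : ∀ {b} → (∀ i j → b i j F.≈ F.0#) → ∀ x → ordered b x R.≈ R.0#
  ordered-zero b≈0 x = ∑-zero {m₁} (λ i → ∑-zero {m₁} (λ j → if-zero (does (i Fin.≤? j)) (b≈0 i j)))
    where
    if-zero : ∀ t {a y} → a F.≈ F.0# → (if t then ιR a R.* y else R.0#) R.≈ R.0#
    if-zero true  a≈0 = R.trans (R.*-congʳ (R.trans (ιR.⟦⟧-cong a≈0) ιR.0#-homo)) (R.zeroˡ _)
    if-zero false _   = R.refl

  ordered-distrib-‿ : ∀ b x → ordered (λ i j → F.- b i j) x R.≈ R.- ordered b x
  ordered-distrib-‿ b x = R.trans
    (∑-cong {m₁} (λ i → R.trans (∑-cong {m₁} (λ j → if-neg (does (i Fin.≤? j))))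
                                (R.sym (-‿distrib-∑ {m₁} _))))
    (R.sym (-‿distrib-∑ {m₁} _))
    where
    if-neg : ∀ t {a y} → (if t then ιR (F.- a) R.* y else R.0#) R.≈ R.- (if t then ιR a R.* y else R.0#)
    if-neg true  = R.trans (R.*-congʳ (ιR.-‿homo _)) (R.sym (Rₚ.-‿distribˡ-* _ _))
    if-neg false = R.sym Rₚ.-0#≈0#

  symmetrize-diagonal : ∀ {n} (A : Fin n → Fin n → F.Carrier) i → symmetrize A i i F.≈ A i i
  symmetrize-diagonal A i with i Fin.≟ i
  ... | yes _   = F.refl
  ... | no i≢i = contradiction ≡-refl i≢i

  symmetrize-off-diagonal : ∀ {n} (A : Fin n → Fin n → F.Carrier) i j → i ≢ j →
                            symmetrize A i j F.≈ A i j F.+ A j i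
  symmetrize-off-diagonal A i j i≢j with i Fin.≟ j
  ... | yes i≡j = contradiction i≡j i≢j
  ... | no _    = F.refl

  annihilator-∂₁∂₁-comm : ∀ a q ℓ → (∀ s → a F.* c₁ q ℓ s F.≈ F.0#) → ∀ x →
                          ιR a R.* ∂₁ q (∂₁ ℓ x) R.≈ ιR a R.* ∂₁ ℓ (∂₁ q x)
  annihilator-∂₁∂₁-comm a q ℓ a·c≈0 x = begin
    ιR a R.* ∂₁ q (∂₁ ℓ x)
      ≈⟨ R.*-congˡ (Rₚ.//-rightDividesˡ (∂₁ ℓ (∂₁ q x)) _) ⟨
    ιR a R.* ([ ∂₁ q , ∂₁ ℓ ] x R.+ ∂₁ ℓ (∂₁ q x))
      ≈⟨ R.trans (R.distribˡ _ _ _) (R.+-congʳ (R.*-congˡ (comm₁ q ℓ x))) ⟩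
    ιR a R.* lc (c₁ q ℓ) (λ s → ∂₁ s x) R.+ ιR a R.* ∂₁ ℓ (∂₁ q x)
      ≈⟨ R.+-congʳ (R.trans (ιR-*-lc a (c₁ q ℓ) _) (lc-zero _ a·c≈0)) ⟩
    R.0# R.+ ιR a R.* ∂₁ ℓ (∂₁ q x)
      ≈⟨ R.+-identityˡ _ ⟩
    ιR a R.* ∂₁ ℓ (∂₁ q x) ∎

  normal-ordering : ∀ (A : Fin m₁ → Fin m₁ → F.Carrier) → (∀ q ℓ s → A q ℓ F.* c₁ q ℓ s F.≈ F.0#) →
                    ∀ x → lc² A (λ q ℓ → ∂₁ q (∂₁ ℓ x)) R.≈ ordered (symmetrize A) x
  normal-ordering A A·c≈0 x = R.trans (∑∑-upper-triangle T)
    (∑-cong {m₁} (λ q → ∑-cong {m₁} (λ ℓ → if-cong (does (q Fin.≤? ℓ)) (merge q ℓ))))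
    where
    T : Fin m₁ → Fin m₁ → R.Carrier
    T q ℓ = ιR (A q ℓ) R.* ∂₁ q (∂₁ ℓ x)
    merge : ∀ q ℓ → (if does (q Fin.≟ ℓ) then T q ℓ else T q ℓ R.+ T ℓ q) R.≈
                    ιR (symmetrize A q ℓ) R.* ∂₁ q (∂₁ ℓ x)
    merge q ℓ with does (q Fin.≟ ℓ)
    ... | true  = R.refl
    ... | false = R.trans (R.+-congˡ (annihilator-∂₁∂₁-comm (A ℓ q) ℓ q (A·c≈0 ℓ q) x))
                          (R.trans (R.sym (R.distribʳ _ _ _)) (R.*-congʳ (R.sym (ιR.+-homo _ _))))
    if-cong : ∀ b {y z} → y R.≈ z → (if b then y else R.0#) R.≈ (if b then z else R.0#)
    if-cong true  y≈z = y≈z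
    if-cong false _   = R.refl

  -- c₁ q ℓ s ≠ 0 forces ε_q 𝔪₁ = 0, and then every cross term with index q vanishes
  jacobiator²-annihilates : ∀ i j k′ q ℓ s → jacobiator² i j k′ q ℓ F.* c₁ q ℓ s F.≈ F.0#
  jacobiator²-annihilates i j k′ q ℓ s with Γ.c₁-vanish q ℓ s
  ... | inj₁ c≈0 = F.trans (F.*-congˡ c≈0) (F.zeroʳ _)
  ... | inj₂ (εq𝔪≈0 , _) = F.trans (F.*-congʳ J²≈0) (F.zeroˡ _)
    where
    cross≈0 : ∀ t f → cross₁ t f q F.≈ F.0#
    cross≈0 t f = L₁.cross-annihilated t f q εq𝔪≈0
    J²≈0 : jacobiator² i j k′ q ℓ F.≈ F.0#
    J²≈0 = F.trans (F.+-cong (F.trans (F.+-cong (cross≈0 i _) (cross≈0 k′ _)) (F.+-identityʳ _)) (cross≈0 j _))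
                   (F.+-identityʳ _)

  jacobi-normal-form : ∀ i j k′ x →
    lc (jacobiator¹ i j k′) (λ s → ∂₁ s x) R.≈ ordered (symmetrize (jacobiator² i j k′)) x
  jacobi-normal-form i j k′ x =
    R.trans (jacobi-identity i j k′ x) (normal-ordering _ (jacobiator²-annihilates i j k′) x)

module IndependenceConsequences {k : Field} {D₁ D₂ : LocalOpSystem k} {𝔽 : DField k D₁ D₂}
                                {Γ : LHSCommSystem 𝔽} (ℛ : DΓRing Γ) (independent : Independent ℛ) where
  private
    module F = Field (DField.F 𝔽)
    m₁ = LocalOpSystem.m D₁
    m₂ = LocalOpSystem.m D₂
  open DΓRing ℛ
  open DΓRingProperties ℛ
  private
    module R = CommutativeRing R
  open import Relation.Binary.Reasoning.Setoid R.setoid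
  private
    module Fₚ = Algebra.Properties.Ring F.ring
    module Rₚ = Algebra.Properties.Ring R.ring

  ∂₁-∂₁∂₂-independent : ∀ (a : Fin m₁ → F.Carrier) (d : Fin m₁ → Fin m₂ → F.Carrier) →
    (∀ x → lc a (λ s → ∂₁ s x) R.+ lc² d (λ i j → ∂₁ i (∂₂ j x)) R.≈ R.0#) → ∀ s → a s F.≈ F.0#
  ∂₁-∂₁∂₂-independent a d rel = proj₁ (independent a (λ _ → F.0#) (λ _ _ → F.0#) d (λ x → begin
    lc a (λ s → ∂₁ s x) R.+ lc (λ _ → F.0#) (λ s → ∂₂ s x) R.+ ordered (λ _ _ → F.0#) x R.+
    lc² d (λ i j → ∂₁ i (∂₂ j x))
      ≈⟨ R.+-congʳ (R.+-cong (R.+-congˡ (lc-zero (λ s → ∂₂ s x) (λ _ → F.refl)))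
                             (ordered-zero (λ _ _ → F.refl) x)) ⟩
    lc a (λ s → ∂₁ s x) R.+ R.0# R.+ R.0# R.+ lc² d (λ i j → ∂₁ i (∂₂ j x))
      ≈⟨ R.+-congʳ (R.trans (R.+-identityʳ _) (R.+-identityʳ _)) ⟩
    lc a (λ s → ∂₁ s x) R.+ lc² d (λ i j → ∂₁ i (∂₂ j x))
      ≈⟨ rel x ⟩
    R.0# ∎))

  ∂₂-∂₁∂₂-independent : ∀ (a : Fin m₂ → F.Carrier) (d : Fin m₁ → Fin m₂ → F.Carrier) →
    (∀ x → lc a (λ s → ∂₂ s x) R.+ lc² d (λ i j → ∂₁ i (∂₂ j x)) R.≈ R.0#) → ∀ s → a s F.≈ F.0#
  ∂₂-∂₁∂₂-independent a d rel = proj₁ (proj₂ (independent (λ _ → F.0#) a (λ _ _ → F.0#) d (λ x → begin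
    lc (λ _ → F.0#) (λ s → ∂₁ s x) R.+ lc a (λ s → ∂₂ s x) R.+ ordered (λ _ _ → F.0#) x R.+
    lc² d (λ i j → ∂₁ i (∂₂ j x))
      ≈⟨ R.+-congʳ (R.+-cong (R.+-congʳ (lc-zero (λ s → ∂₁ s x) (λ _ → F.refl)))
                             (ordered-zero (λ _ _ → F.refl) x)) ⟩
    R.0# R.+ lc a (λ s → ∂₂ s x) R.+ R.0# R.+ lc² d (λ i j → ∂₁ i (∂₂ j x))
      ≈⟨ R.+-congʳ (R.trans (R.+-identityʳ _) (R.+-identityˡ _)) ⟩
    lc a (λ s → ∂₂ s x) R.+ lc² d (λ i j → ∂₁ i (∂₂ j x))
      ≈⟨ rel x ⟩
    R.0# ∎)))

  ∂₁-∂₁∂₁-independent : ∀ (a : Fin m₁ → F.Carrier) (b : Fin m₁ → Fin m₁ → F.Carrier) →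
    (∀ x → lc a (λ s → ∂₁ s x) R.≈ ordered b x) →
    (∀ s → a s F.≈ F.0#) × (∀ i j → i Fin.≤ j → b i j F.≈ F.0#)
  ∂₁-∂₁∂₁-independent a b rel
    with independent a (λ _ → F.0#) (λ i j → F.- b i j) (λ _ _ → F.0#) (λ x → begin
      lc a (λ s → ∂₁ s x) R.+ lc (λ _ → F.0#) (λ s → ∂₂ s x) R.+ ordered (λ i j → F.- b i j) x R.+
      lc² (λ _ _ → F.0#) (λ i j → ∂₁ i (∂₂ j x))
        ≈⟨ R.+-cong (R.+-cong (R.+-congˡ (lc-zero (λ s → ∂₂ s x) (λ _ → F.refl))) (ordered-distrib-‿ b x))
                    (lc²-zero (λ i j → ∂₁ i (∂₂ j x)) (λ _ _ → F.refl)) ⟩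
      lc a (λ s → ∂₁ s x) R.+ R.0# R.- ordered b x R.+ R.0#
        ≈⟨ R.trans (R.+-identityʳ _) (R.+-congʳ (R.+-identityʳ _)) ⟩
      lc a (λ s → ∂₁ s x) R.- ordered b x
        ≈⟨ Rₚ.x≈y⇒x∙y⁻¹≈ε (rel x) ⟩
      R.0# ∎)
  ... | a≈0 , _ , -b≈0 , _ = a≈0 , λ i j i≤j → -y≈0⇒y≈0 (-b≈0 i j i≤j)
    where
    -y≈0⇒y≈0 : ∀ {y} → F.- y F.≈ F.0# → y F.≈ F.0#
    -y≈0⇒y≈0 -y≈0 = F.trans (F.sym (Fₚ.-‿involutive _)) (F.trans (F.-‿cong -y≈0) Fₚ.-0#≈0#)

  lc-∂₁-injective : ∀ (u v : Fin m₁ → F.Carrier) →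
    (∀ x → lc u (λ s → ∂₁ s x) R.≈ lc v (λ s → ∂₁ s x)) → ∀ s → u s F.≈ v s
  lc-∂₁-injective u v u≈v s = Fₚ.x∙y⁻¹≈ε⇒x≈y _ _ (∂₁-∂₁∂₂-independent (λ s → u s F.- v s) (λ _ _ → F.0#) (λ x →
    R.trans (R.+-cong (R.trans (lc-distribˡ-- u v _) (Rₚ.x≈y⇒x∙y⁻¹≈ε (u≈v x))) (lc²-zero (λ i j → ∂₁ i (∂₂ j x)) (λ _ _ → F.refl)))
            (R.+-identityʳ R.0#)) s)

  lc-∂₂-injective : ∀ (u v : Fin m₂ → F.Carrier) →
    (∀ x → lc u (λ s → ∂₂ s x) R.≈ lc v (λ s → ∂₂ s x)) → ∀ s → u s F.≈ v s
  lc-∂₂-injective u v u≈v s = Fₚ.x∙y⁻¹≈ε⇒x≈y _ _ (∂₂-∂₁∂₂-independent (λ s → u s F.- v s) (λ _ _ → F.0#) (λ x →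
    R.trans (R.+-cong (R.trans (lc-distribˡ-- u v _) (Rₚ.x≈y⇒x∙y⁻¹≈ε (u≈v x))) (lc²-zero (λ i j → ∂₁ i (∂₂ j x)) (λ _ _ → F.refl)))
            (R.+-identityʳ R.0#)) s)

module JacobiConditions {k : Field} {D₁ D₂ : LocalOpSystem k} {𝔽 : DField k D₁ D₂}
                        {Γ : LHSCommSystem 𝔽} (ℛ : DΓRing Γ) (independent : Independent ℛ) where
  private
    module 𝔽 = DField 𝔽
    module F = Field 𝔽.F
    module F∑ = SumProperties F.commRing
    module Fₚ = Algebra.Properties.Ring F.ring
    m₁ = LocalOpSystem.m D₁
    α₁ = LocalOpSystem.α D₁
    α₂ = LocalOpSystem.α D₂
    ∑F = ∑ F.commRing
  open LHSCommSystem Γ using (c₁; c₂)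
  open DΓRingProperties ℛ
  open IndependenceConsequences ℛ independent
  open import Algebra.Properties.CommutativeSemigroup F.+-commutativeSemigroup using (xy∙z≈zx∙y)

  skew : ∀ i j ℓ → c₁ i j ℓ F.≈ F.- c₁ j i ℓ
  skew i j = lc-∂₁-injective (c₁ i j) (λ ℓ → F.- c₁ j i ℓ) (c₁-antisymmetric i j)

  assoc₂ : ∀ i j k′ s →
    ∑F (λ ℓ → c₂ i j ℓ F.* c₂ ℓ k′ s F.- c₂ j k′ ℓ F.* c₂ i ℓ s
             F.- ∑F (λ p → ∑F (λ q →
                   𝔽.ι (α₂ (suc p) (suc q) (suc i)) F.* 𝔽.∂₂ p (c₂ j k′ ℓ) F.* c₂ q ℓ s)))
    F.≈ 𝔽.∂₂ i (c₂ j k′ s)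
  assoc₂ i j k′ = lc-∂₂-injective _ _ (c₂-associative i j k′)

  indep₁₂ : ∀ k′ i j s → 𝔽.∂₁ k′ (c₂ i j s) F.≈ F.0#
  indep₁₂ k′ i j = ∂₂-∂₁∂₂-independent _ _ (∂₁-of-comm₂ k′ i j)

  indep₂₁ : ∀ k′ i j s → 𝔽.∂₂ k′ (c₁ i j s) F.≈ F.0#
  indep₂₁ k′ i j = ∂₁-∂₁∂₂-independent _ _ (∂₂-of-comm₁ k′ i j)

  jacobiators-vanish : ∀ i j k′ →
    (∀ s → jacobiator¹ i j k′ s F.≈ F.0#) ×
    (∀ q ℓ → q Fin.≤ ℓ → symmetrize (jacobiator² i j k′) q ℓ F.≈ F.0#)
  jacobiators-vanish i j k′ = ∂₁-∂₁∂₁-independent _ _ (jacobi-normal-form i j k′)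

  jacobi : ∀ i j k′ s →
    ∑F (λ ℓ → c₁ i j ℓ F.* c₁ ℓ k′ s F.+ c₁ k′ i ℓ F.* c₁ ℓ j s F.+ c₁ j k′ ℓ F.* c₁ ℓ i s)
    F.≈ 𝔽.∂₁ i (c₁ j k′ s) F.+ 𝔽.∂₁ k′ (c₁ i j s) F.+ 𝔽.∂₁ j (c₁ k′ i s)
  jacobi i j k′ s = F.trans (F.trans (F∑.∑-distrib-+₃ {m₁} _ _ _) (xy∙z≈zx∙y _ _ _))
    (Fₚ.x∙y⁻¹≈ε⇒x≈y _ _ (F.trans (F.sym ([a-b]+[c-d]+[e-f]≈[a+c+e]-[b+d+f] _ _ _ _ _ _))
                                 (proj₁ (jacobiators-vanish i j k′) s)))
    where open AdditiveProperties F.commRing using ([a-b]+[c-d]+[e-f]≈[a+c+e]-[b+d+f])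

  mixed₁ : ∀ i j k′ s →
    ∑F (λ p → 𝔽.ι (α₁ (suc p) (suc s) (suc i)) F.* 𝔽.∂₁ p (c₁ j k′ s)
            F.+ 𝔽.ι (α₁ (suc p) (suc s) (suc k′)) F.* 𝔽.∂₁ p (c₁ i j s)
            F.+ 𝔽.ι (α₁ (suc p) (suc s) (suc j)) F.* 𝔽.∂₁ p (c₁ k′ i s))
    F.≈ F.0#
  mixed₁ i j k′ s = F.trans (F∑.∑-distrib-+₃ {m₁} _ _ _)
    (F.trans (F.sym (symmetrize-diagonal (jacobiator² i j k′) s))
             (proj₂ (jacobiators-vanish i j k′) s s Finₚ.≤-refl))

  mixed₂ : ∀ i j k′ q s → q Fin.< s →
    ∑F (λ p → 𝔽.ι (α₁ (suc p) (suc q) (suc i)) F.* 𝔽.∂₁ p (c₁ j k′ s)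
            F.+ 𝔽.ι (α₁ (suc p) (suc q) (suc k′)) F.* 𝔽.∂₁ p (c₁ i j s)
            F.+ 𝔽.ι (α₁ (suc p) (suc q) (suc j)) F.* 𝔽.∂₁ p (c₁ k′ i s)
            F.+ 𝔽.ι (α₁ (suc p) (suc s) (suc i)) F.* 𝔽.∂₁ p (c₁ j k′ q)
            F.+ 𝔽.ι (α₁ (suc p) (suc s) (suc k′)) F.* 𝔽.∂₁ p (c₁ i j q)
            F.+ 𝔽.ι (α₁ (suc p) (suc s) (suc j)) F.* 𝔽.∂₁ p (c₁ k′ i q))
    F.≈ F.0#
  mixed₂ i j k′ q s q<s = F.trans
    (F.trans (F∑.∑-cong {m₁} (λ p → reassociate _ _ _ _ _ _))
             (F.trans (F∑.∑-distrib-+ {m₁} _ _)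
                      (F.+-cong (F∑.∑-distrib-+₃ {m₁} _ _ _) (F∑.∑-distrib-+₃ {m₁} _ _ _))))
    (F.trans (F.sym (symmetrize-off-diagonal (jacobiator² i j k′) q s (Finₚ.<⇒≢ q<s)))
             (proj₂ (jacobiators-vanish i j k′) q s (ℕₚ.<⇒≤ q<s)))
    where
    reassociate : ∀ a b c d e f → a F.+ b F.+ c F.+ d F.+ e F.+ f F.≈ (a F.+ b F.+ c) F.+ (d F.+ e F.+ f)
    reassociate a b c d e f =
      F.trans (F.+-assoc _ e f) (F.trans (F.+-assoc _ d (e F.+ f)) (F.+-congˡ (F.sym (F.+-assoc d e f))))

proposition4p19 : (k : Field) (D₁ D₂ : LocalOpSystem k) (𝔽 : DField k D₁ D₂)
                  (Γ : LHSCommSystem 𝔽) →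
                  Σ (DΓRing Γ) Independent →
                  JacobiAssociative Γ
proposition4p19 k D₁ D₂ 𝔽 Γ (ℛ , independent) = record
  { skew = skew ; jacobi = jacobi ; mixed₁ = mixed₁ ; mixed₂ = mixed₂
  ; assoc₂ = assoc₂ ; indep₁₂ = indep₁₂ ; indep₂₁ = indep₂₁ }
  where open JacobiConditions ℛ independent
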